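{- Let $c\ge 2$. For a vector $(p_1,\dots,p_c)$ of nonnegative integers define the $c$-edge-colored graph $G(p_1,\dots,p_c)$ recursively: $G(0,\dots,0)=K_1$; otherwise take a new vertex $x$ and, for each $i$ with $p_i>0$, a (disjoint) copy $H_i$ of $G(p_1,\dots,p_{i-1},p_i-1,p_{i+1},\dots,p_c)$, and join $x$ to every vertex of $H_i$ by an edge of color $i$, for each $i$ with $p_i>0$. Let $n(p_1,\dots,p_c)$ denote the order of $G(p_1,\dots,p_c)$, and for an integer $p\ge 0$ let $n_c(p)=n(p,p,\dots,p)$. Then (i) if $s=p_1+\dots+p_c>0$, we have $n(p_1,\dots,p_c)\le s\,c^{s}$; and (ii) for every integer $p\ge 1$, $p\ge \frac1c\left(\log_c n_c(p)-\log_c\log_c n_c(p)\right)$.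
   Context: A $c$-edge-colored graph is a simple graph with a fixed (not necessarily proper) coloring of its edges by colors $1,\dots,c$. -}

module Defs where

open import Data.Nat using (ℕ; zero; suc; _+_; pred)
open import Data.Fin using (Fin; zero; suc; splitAt)
open import Data.Vec using (Vec; lookup; updateAt; replicate; sum)
open import Data.List using (List; []; _∷_; mapMaybe; allFin)
open import Data.Maybe using (Maybe; just; nothing)
open import Data.Sum using (inj₁; inj₂)
open import Data.Product using (_×_; _,_)

-- A c-edge-colored graph: vertices Fin order; colour u v = just i means
-- uv is an edge of colour i, nothing means non-adjacent.
record ColGraph (c : ℕ) : Set where
  field
    order  : ℕ
    colour : Fin order → Fin order → Maybe (Fin c)

open ColGraph public

K1 : ∀ {c} → ColGraph c
K1 = record { order = 1 ; colour = λ _ _ → nothing }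

_⊕_ : ∀ {c} → ColGraph c → ColGraph c → ColGraph c
_⊕_ {c} G H = record { order = order G + order H ; colour = col }
  where
  col : Fin (order G + order H) → Fin (order G + order H) → Maybe (Fin c)
  col u v with splitAt (order G) u | splitAt (order G) v
  ... | inj₁ u' | inj₁ v' = colour G u' v'
  ... | inj₂ u' | inj₂ v' = colour H u' v'
  ... | _       | _       = nothing

Union : ∀ {c} → List (Fin c × ColGraph c) → ColGraph c
Union [] = record { order = 0 ; colour = λ () }
Union ((i , H) ∷ bs) = H ⊕ Union bs

blockColour : ∀ {c} (bs : List (Fin c × ColGraph c)) → Fin (order (Union bs)) → Fin c
blockColour [] ()
blockColour ((i , H) ∷ bs) v with splitAt (order H) v
... | inj₁ _  = i
... | inj₂ v' = blockColour bs v'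

Star : ∀ {c} → List (Fin c × ColGraph c) → ColGraph c
Star {c} bs = record { order = suc (order (Union bs)) ; colour = col }
  where
  col : Fin (suc (order (Union bs))) → Fin (suc (order (Union bs))) → Maybe (Fin c)
  col zero    zero    = nothing
  col zero    (suc v) = just (blockColour bs v)
  col (suc u) zero    = just (blockColour bs u)
  col (suc u) (suc v) = colour (Union bs) u v

-- G with fuel s (called with s = p₁ + ⋯ + p_c, so every recursive
-- argument has coordinate sum exactly one less)
Gfuel : ∀ {c} → ℕ → Vec ℕ c → ColGraph c
Gfuel zero    p = K1
Gfuel {c} (suc s) p = Star (mapMaybe block (allFin c))
  where
  block : Fin c → Maybe (Fin c × ColGraph c)
  block i with lookup p i
  ... | zero  = nothing
  ... | suc _ = just (i , Gfuel s (updateAt p i pred))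

G : ∀ {c} → Vec ℕ c → ColGraph c
G p = Gfuel (sum p) p

n : ∀ {c} → Vec ℕ c → ℕ
n p = order (G p)

nc : ∀ c → ℕ → ℕ
nc c p = n (replicate c p)

-- G(p) is a root joined to at most min(c, s) copies of graphs G(p − eᵢ) with coordinate
-- sum s − 1, so n(p) ≤ 1 + c (s − 1) c^(s−1) ≤ s c^s, the step s = 1 using that only one
-- block is present. For p = (p,…,p) with p ≥ 1 all c blocks are present, so c ≤ N := n_c(p),
-- and the bound N ≤ s c^s with s = cp gives c^N ≤ N^(c^s): if N ≤ c^s use c^N ≤ N^N,
-- otherwise c^N ≤ c^(s c^s) = (c^s)^(c^s) ≤ N^(c^s).
module Submission where

open import Defs
open import Data.Nat using (ℕ; zero; suc; _+_; _*_; _^_; pred; _≤_; _<_; z≤n; s≤s; z<s; >-nonZero)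
open import Data.Nat.Properties
open import Algebra.Properties.CommutativeSemigroup *-commutativeSemigroup using (x∙yz≈y∙xz)
open import Data.Fin using (Fin; zero; suc)
open import Data.Vec using (Vec; []; _∷_; sum; updateAt; lookup; replicate)
open import Data.Vec.Properties using (lookup-replicate)
open import Data.List using (List; []; _∷_; catMaybes; mapMaybe; tabulate; length; allFin)
open import Data.List.Properties using (length-catMaybes; length-tabulate; map-tabulate)
open import Data.List.Relation.Unary.All using (All; []; _∷_)
open import Data.List.Relation.Unary.All.Properties using (All-catMaybes⁺; tabulate⁺)
open import Data.Maybe using (Maybe; just; nothing; Is-just)
import Data.Maybe.Relation.Unary.All as Maybe
open import Data.Maybe.Relation.Unary.Any using (just)
open import Data.Product using (_×_; _,_; proj₂)
open import Data.Unit using (tt)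
open import Function using (id; _∘_)
open import Relation.Nullary using (yes; no)
open import Relation.Binary.PropositionalEquality

private
  variable
    A : Set
    c : ℕ

length-catMaybes-tabulate-≤-sum : (p : Vec ℕ c) (f : Fin c → Maybe A) →
  (∀ i → lookup p i ≡ 0 → f i ≡ nothing) → length (catMaybes (tabulate f)) ≤ sum p
length-catMaybes-tabulate-≤-sum []          f zero⇒nothing = z≤n
length-catMaybes-tabulate-≤-sum (zero ∷ p)  f zero⇒nothing rewrite zero⇒nothing zero refl =
  length-catMaybes-tabulate-≤-sum p (f ∘ suc) (zero⇒nothing ∘ suc)
length-catMaybes-tabulate-≤-sum (suc x ∷ p) f zero⇒nothing with f zero
... | nothing = m≤n⇒m≤o+n (suc x) (length-catMaybes-tabulate-≤-sum p (f ∘ suc) (zero⇒nothing ∘ suc))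
... | just _  = s≤s (m≤n⇒m≤o+n x (length-catMaybes-tabulate-≤-sum p (f ∘ suc) (zero⇒nothing ∘ suc)))

length-catMaybes-All-Is-just : {xs : List (Maybe A)} → All Is-just xs → length (catMaybes xs) ≡ length xs
length-catMaybes-All-Is-just []             = refl
length-catMaybes-All-Is-just (just _ ∷ js) = cong suc (length-catMaybes-All-Is-just js)

sum-replicate : ∀ c x → sum (replicate c x) ≡ c * x
sum-replicate zero    x = refl
sum-replicate (suc c) x = cong (x +_) (sum-replicate c x)

sum-updateAt-pred : (p : Vec ℕ c) (i : Fin c) {k : ℕ} →
  lookup p i ≡ suc k → sum p ≡ suc (sum (updateAt p i pred))
sum-updateAt-pred (x ∷ p) zero    refl = refl
sum-updateAt-pred (x ∷ p) (suc i) pᵢ   = trans (cong (x +_) (sum-updateAt-pred p i pᵢ)) (+-suc x _)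

order-Union-≤ : ∀ {m} (bs : List (Fin c × ColGraph c)) →
  All (λ b → order (proj₂ b) ≤ m) bs → order (Union bs) ≤ length bs * m
order-Union-≤ []       []       = z≤n
order-Union-≤ (b ∷ bs) (h ∷ hs) = +-mono-≤ h (order-Union-≤ bs hs)

order-Union-≥ : ∀ {m} (bs : List (Fin c × ColGraph c)) →
  All (λ b → m ≤ order (proj₂ b)) bs → length bs * m ≤ order (Union bs)
order-Union-≥ []       []       = z≤n
order-Union-≥ (b ∷ bs) (h ∷ hs) = +-mono-≤ h (order-Union-≥ bs hs)

-- The block function of Gfuel is local to its where clause; the metavariable
-- below is solved by the refl proof of Gfuel-suc, which gives it a name.
mutual
  blockOf : ℕ → Vec ℕ c → Fin c → Maybe (Fin c × ColGraph c)
  blockOf = _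

  Gfuel-suc : ∀ s (p : Vec ℕ c) → Gfuel (suc s) p ≡ Star (mapMaybe (blockOf s p) (allFin c))
  Gfuel-suc s p = refl

blocks : ℕ → Vec ℕ c → List (Fin c × ColGraph c)
blocks s p = catMaybes (tabulate (blockOf s p))

order-Gfuel-suc : ∀ s (p : Vec ℕ c) → order (Gfuel (suc s) p) ≡ suc (order (Union (blocks s p)))
order-Gfuel-suc s p rewrite Gfuel-suc s p =
  cong (suc ∘ order ∘ Union ∘ catMaybes) (map-tabulate id (blockOf s p))

0<order-Gfuel : ∀ s (p : Vec ℕ c) → 0 < order (Gfuel s p)
0<order-Gfuel zero    p = z<s
0<order-Gfuel (suc s) p = z<s

blockOf-nothing : ∀ s (p : Vec ℕ c) i → lookup p i ≡ 0 → blockOf s p i ≡ nothing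
blockOf-nothing s p i pᵢ rewrite pᵢ = refl

blockOf-Is-just : ∀ s (p : Vec ℕ c) i → 0 < lookup p i → Is-just (blockOf s p i)
blockOf-Is-just s p i 0<pᵢ with lookup p i
... | suc _ = just tt

blockOf-All : ∀ (P : ColGraph c → Set) s (p : Vec ℕ c) i →
  (∀ {k} → lookup p i ≡ suc k → P (Gfuel s (updateAt p i pred))) →
  Maybe.All (P ∘ proj₂) (blockOf s p i)
blockOf-All P s p i h with lookup p i
... | zero  = Maybe.nothing
... | suc _ = Maybe.just (h refl)

All-blocks : ∀ (P : ColGraph c → Set) s (p : Vec ℕ c) →
  (∀ i {k} → lookup p i ≡ suc k → P (Gfuel s (updateAt p i pred))) →
  All (P ∘ proj₂) (blocks s p)
All-blocks P s p h = All-catMaybes⁺ (tabulate⁺ λ i → blockOf-All P s p i (h i))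

length-blocks-≤ : ∀ s (p : Vec ℕ c) → length (blocks s p) ≤ c
length-blocks-≤ s p = ≤-trans (length-catMaybes (tabulate (blockOf s p)))
                              (≤-reflexive (length-tabulate (blockOf s p)))

length-blocks-≤-sum : ∀ s (p : Vec ℕ c) → length (blocks s p) ≤ sum p
length-blocks-≤-sum s p = length-catMaybes-tabulate-≤-sum p (blockOf s p) (blockOf-nothing s p)

length-blocks-positive : ∀ s (p : Vec ℕ c) → (∀ i → 0 < lookup p i) → length (blocks s p) ≡ c
length-blocks-positive s p 0<p =
  trans (length-catMaybes-All-Is-just (tabulate⁺ λ i → blockOf-Is-just s p i (0<p i)))
        (length-tabulate (blockOf s p))

1+c*[m*c^m]≤[1+m]*c^[1+m] : ∀ {c} m → 0 < c → suc (c * (m * c ^ m)) ≤ suc m * c ^ suc m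
1+c*[m*c^m]≤[1+m]*c^[1+m] {c} m 0<c = begin
  suc (c * (m * c ^ m))  ≡⟨ cong suc (x∙yz≈y∙xz c m (c ^ m)) ⟩
  suc (m * c ^ suc m)    ≤⟨ +-monoˡ-≤ _ (m^n>0 c {{>-nonZero 0<c}} (suc m)) ⟩
  suc m * c ^ suc m      ∎
  where open ≤-Reasoning

order-Gfuel-suc-≤ : ∀ s (p : Vec ℕ c) {m} →
  (∀ i {k} → lookup p i ≡ suc k → order (Gfuel s (updateAt p i pred)) ≤ m) →
  order (Gfuel (suc s) p) ≤ suc (length (blocks s p) * m)
order-Gfuel-suc-≤ s p {m} blockBound = begin
  order (Gfuel (suc s) p)           ≡⟨ order-Gfuel-suc s p ⟩
  suc (order (Union (blocks s p)))  ≤⟨ s≤s (order-Union-≤ _ (All-blocks _ s p blockBound)) ⟩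
  suc (length (blocks s p) * m)     ∎
  where open ≤-Reasoning

order-Gfuel-≤ : 2 ≤ c → ∀ s (p : Vec ℕ c) → sum p ≡ s → 0 < s → order (Gfuel s p) ≤ s * c ^ s
order-Gfuel-≤ {c} c≥2 (suc zero) p Σp≡1 _ = begin
  order (Gfuel 1 p)              ≤⟨ order-Gfuel-suc-≤ 0 p (λ _ _ → ≤-refl) ⟩
  suc (length (blocks 0 p) * 1)  ≡⟨ cong suc (*-identityʳ _) ⟩
  suc (length (blocks 0 p))      ≤⟨ s≤s (≤-trans (length-blocks-≤-sum 0 p) (≤-reflexive Σp≡1)) ⟩
  2                              ≤⟨ c≥2 ⟩
  c                              ≡⟨ sym (trans (*-identityˡ (c ^ 1)) (*-identityʳ c)) ⟩
  1 * c ^ 1                      ∎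
  where open ≤-Reasoning
order-Gfuel-≤ {c} c≥2 (suc (suc s)) p Σp≡2+s _ = begin
  order (Gfuel (2 + s) p)                  ≤⟨ order-Gfuel-suc-≤ (suc s) p (λ i pᵢ →
                                                order-Gfuel-≤ c≥2 (suc s) _ (sum-p-eᵢ i pᵢ) z<s) ⟩
  suc (length (blocks (suc s) p) * bound)  ≤⟨ s≤s (*-monoˡ-≤ bound (length-blocks-≤ (suc s) p)) ⟩
  suc (c * bound)                          ≤⟨ 1+c*[m*c^m]≤[1+m]*c^[1+m] (suc s) (≤-trans z<s c≥2) ⟩
  (2 + s) * c ^ (2 + s)                    ∎
  where
  open ≤-Reasoning
  bound : ℕ
  bound = suc s * c ^ suc s
  sum-p-eᵢ : ∀ i {k} → lookup p i ≡ suc k → sum (updateAt p i pred) ≡ suc s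
  sum-p-eᵢ i pᵢ = suc-injective (trans (sym (sum-updateAt-pred p i pᵢ)) Σp≡2+s)

c≤order-Gfuel : ∀ s (p : Vec ℕ c) → (∀ i → 0 < lookup p i) → 0 < s → c ≤ order (Gfuel s p)
c≤order-Gfuel {c} (suc s) p 0<p _ = begin
  c                                 ≡⟨ sym (length-blocks-positive s p 0<p) ⟩
  length (blocks s p)               ≡⟨ sym (*-identityʳ _) ⟩
  length (blocks s p) * 1           ≤⟨ order-Union-≥ _ (All-blocks _ s p λ i _ → 0<order-Gfuel s _) ⟩
  order (Union (blocks s p))        ≤⟨ n≤1+n _ ⟩
  suc (order (Union (blocks s p)))  ≡⟨ sym (order-Gfuel-suc s p) ⟩
  order (Gfuel (suc s) p)           ∎
  where open ≤-Reasoning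

c^N≤N^[c^s] : ∀ {c N} s → 0 < c → c ≤ N → N ≤ s * c ^ s → c ^ N ≤ N ^ (c ^ s)
c^N≤N^[c^s] {c} {N} s 0<c c≤N N≤s*c^s with N ≤? c ^ s
... | yes N≤c^s = begin
  c ^ N        ≤⟨ ^-monoˡ-≤ N c≤N ⟩
  N ^ N        ≤⟨ ^-monoʳ-≤ N {{>-nonZero (≤-trans 0<c c≤N)}} N≤c^s ⟩
  N ^ (c ^ s)  ∎
  where open ≤-Reasoning
... | no N≰c^s = begin
  c ^ N              ≤⟨ ^-monoʳ-≤ c {{>-nonZero 0<c}} N≤s*c^s ⟩
  c ^ (s * c ^ s)    ≡⟨ sym (^-*-assoc c s (c ^ s)) ⟩
  (c ^ s) ^ (c ^ s)  ≤⟨ ^-monoˡ-≤ (c ^ s) (<⇒≤ (≰⇒> N≰c^s)) ⟩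
  N ^ (c ^ s)        ∎
  where open ≤-Reasoning

mainTheorem2 : (c : ℕ) → 2 ≤ c →
    ((ps : Vec ℕ c) → 0 < sum ps → n ps ≤ sum ps * c ^ sum ps)
    × ((p : ℕ) → 1 ≤ p → c ^ (nc c p) ≤ (nc c p) ^ (c ^ (c * p)))
mainTheorem2 c c≥2 = (λ ps → order-Gfuel-≤ c≥2 (sum ps) ps refl) , nc-bound
  where
  0<c : 0 < c
  0<c = ≤-trans z<s c≥2

  nc-bound : (p : ℕ) → 1 ≤ p → c ^ (nc c p) ≤ (nc c p) ^ (c ^ (c * p))
  nc-bound p 0<p = c^N≤N^[c^s] (c * p) 0<c
      (c≤order-Gfuel (sum ps) ps (λ i → subst (0 <_) (sym (lookup-replicate i p)) 0<p) 0<Σps)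
      (subst (λ s → nc c p ≤ s * c ^ s) (sum-replicate c p) (order-Gfuel-≤ c≥2 (sum ps) ps refl 0<Σps))
    where
    ps = replicate c p
    0<Σps : 0 < sum ps
    0<Σps = subst (0 <_) (sym (sum-replicate c p)) (*-mono-≤ 0<c 0<p)
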